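{- Let $B\in\mathrm{M}_3(\mathbb{R})$ be a cluster-cyclic skew-symmetrizable matrix, fix $i\in\{1,2,3\}$, and put $k_0=K([i])=i$, $s_0=S([i])$, $t_0=T([i])$. For every integer $n\ge0$: (a) $(K([i]S^n),S([i]S^n))=(k_0,s_0)$ if $n$ is even and $=(s_0,k_0)$ if $n$ is odd, and $T([i]S^n)=t_0$; (b) $\varepsilon_{k_0}^{[i]S^n}=(-1)^{n+1}$, $\varepsilon_{s_0}^{[i]S^n}=(-1)^n$, and $\varepsilon_{t_0}^{[i]S^n}=1$.
   Context: A matrix $B=(b_{ij})\in\mathrm{M}_3(\mathbb{R})$ is skew-symmetrizable if $DB$ is skew-symmetric for some positive diagonal $D$. Notation: $[a]_+=\max(a,0)$, entrywise; $J_k$ diagonal with $k$th entry $-1$, others $1$; $A^{\bullet k}$ (resp. $A^{k\bullet}$) keeps only the $k$th column (resp. row) of $A$. Mutation: $\mu_k(B)=(J_k+[-B]_+^{\bullet k})B(J_k+[B]_+^{k\bullet})$. $\mathcal T$: reduced sequences $\mathbf w=[k_1,\dots,k_r]$ ($k_i\in\{1,2,3\}$, $k_i\ne k_{i+1}$), including $\emptyset$; $\mathbf w[k]$ appends $k$ if $\mathbf w=\emptyset$ or $k\ne k_r$, deletes the last entry if $k=k_r$. $B^{\mathbf w}=\mu_{k_r}\cdots\mu_{k_1}(B)=(b^{\mathbf w}_{ij})$. $C^\emptyset=I$, $C^{\mathbf w[k]}=C^{\mathbf w}J_k+C^{\mathbf w}[B^{\mathbf w}]_+^{k\bullet}+[-C^{\mathbf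 w}]_+^{\bullet k}B^{\mathbf w}$, columns $\mathbf c_i^{\mathbf w}$. $B$ is cyclic if $\mathrm{sign}(B)=\pm\begin{pmatrix}0&-1&1\\1&0&-1\\-1&1&0\end{pmatrix}$ entrywise; cluster-cyclic if all $B^{\mathbf w}$ are cyclic. For cluster-cyclic $B$ all $\mathbf c_i^{\mathbf w}$ are nonzero and componentwise $\ge0$ or $\le 0$, with tropical signs $\varepsilon_i^{\mathbf w}\in\{\pm1\}$, $\varepsilon_i^{\mathbf w}\mathbf c_i^{\mathbf w}\ge\mathbf 0$. For $\mathbf w\ne\emptyset$ with last index $k$ there is a unique $s\ne k$ with $\varepsilon_s^{\mathbf w}\mathrm{sign}(b^{\mathbf w}_{ks})=-1$ and $\varepsilon_k^{\mathbf w}\ne\varepsilon_s^{\mathbf w}$; $t$ is the third index; $K(\mathbf w)=k$, $S(\mathbf w)=s$, $T(\mathbf w)=t$. The free monoid $\mathcal M$ on $S,T$ acts on the right on $\mathcal T\setminus\{\emptyset\}$ by $\mathbf wS=\mathbf w[S(\mathbf w)]$, $\mathbf wT=\mathbf w[T(\mathbf w)]$; $[i]S^n$ denotes $[i]$ acted on by $S$ $n$ times. -}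

module Defs where

open import Level using (0ℓ)
open import Data.Fin using (Fin; zero; suc)
open import Data.Fin.Properties using () renaming (_≟_ to _≟F_)
open import Data.Nat using (ℕ) renaming (zero to nzero; suc to nsuc)
open import Data.Integer using (ℤ; +_; -[1+_]) renaming (-_ to -ℤ_)
open import Data.List using (List; []; _∷_)
open import Data.Sign using (Sign) renaming (+ to s+; - to s-; opposite to sopp)
open import Data.Product using (Σ; _×_; _,_)
open import Data.Sum using (_⊎_)
open import Data.Empty using (⊥)
open import Data.Unit using (⊤)
import Data.Integer
import Data.Integer.Properties as ℤP
import Data.Sign
import Data.Sign.Properties as SP
import Data.Product
open import Relation.Nullary using (¬_; yes; no)
open import Relation.Binary.Definitions using (tri<; tri≈; tri>)
open import Relation.Binary.PropositionalEquality using (_≡_)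
open import Algebra.Structures using (IsCommutativeRing)
open import Relation.Binary.Structures using (IsStrictTotalOrder)

-- An axiomatic copy of the real numbers: a complete ordered field
-- (with propositional equality as the equality).  Any two such are
-- isomorphic to ℝ, so quantifying over all of them is exactly the
-- statement for ℝ.
record RealField : Set₁ where
  infixl 6 _+_
  infixl 7 _*_
  infix 4 _<_ _≤_
  field
    ℝ   : Set
    _+_ _*_ : ℝ → ℝ → ℝ
    -_  : ℝ → ℝ
    0# 1# : ℝ
    _<_ : ℝ → ℝ → Set
    isCommutativeRing  : IsCommutativeRing _≡_ _+_ _*_ -_ 0# 1#
    0≢1                : ¬ (0# ≡ 1#)
    inverse            : (x : ℝ) → ¬ (x ≡ 0#) → Σ ℝ (λ y → x * y ≡ 1#)
    isStrictTotalOrder : IsStrictTotalOrder _≡_ _<_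
    +-mono-<           : ∀ {x y} z → x < y → x + z < y + z
    *-pos              : ∀ {x y} → 0# < x → 0# < y → 0# < x * y

  _≤_ : ℝ → ℝ → Set
  x ≤ y = (x < y) ⊎ (x ≡ y)

  field
    complete : (P : ℝ → Set) → Σ ℝ P → Σ ℝ (λ b → ∀ x → P x → x ≤ b) →
               Σ ℝ (λ s → (∀ x → P x → x ≤ s) ×
                          (∀ b → (∀ x → P x → x ≤ b) → s ≤ b))

  open IsStrictTotalOrder isStrictTotalOrder public using (compare)

module ClusterDefs (F : RealField) where
  open RealField F

  -- 3×3 real matrices, indices {1,2,3} represented by Fin 3
  Mat : Set
  Mat = Fin 3 → Fin 3 → ℝ

  _⊗_ : Mat → Mat → Mat
  (A ⊗ B) i j = A i zero * B zero j + A i (suc zero) * B (suc zero) j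
                + A i (suc (suc zero)) * B (suc (suc zero)) j

  _⊕_ : Mat → Mat → Mat
  (A ⊕ B) i j = A i j + B i j

  negM : Mat → Mat
  negM A i j = - A i j

  [_]₊ : ℝ → ℝ
  [ a ]₊ with compare a 0#
  ... | tri< _ _ _ = 0#
  ... | tri≈ _ _ _ = 0#
  ... | tri> _ _ _ = a

  posM : Mat → Mat
  posM A i j = [ A i j ]₊

  J : Fin 3 → Mat
  J k i j with i ≟F j
  ... | no _ = 0#
  ... | yes _ with i ≟F k
  ...   | yes _ = - 1#
  ...   | no _  = 1#

  col : Fin 3 → Mat → Mat
  col k A i j with j ≟F k
  ... | yes _ = A i j
  ... | no _  = 0#

  row : Fin 3 → Mat → Mat
  row k A i j with i ≟F k
  ... | yes _ = A i j
  ... | no _  = 0#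

  μ : Fin 3 → Mat → Mat
  μ k B = ((J k ⊕ col k (posM (negM B))) ⊗ B) ⊗ (J k ⊕ row k (posM B))

  skewSymmetrizable : Mat → Set
  skewSymmetrizable B = Σ (Fin 3 → ℝ) λ d →
    (∀ i → 0# < d i) × (∀ i j → d i * B i j ≡ - (d j * B j i))

  sgn : ℝ → ℤ
  sgn a with compare a 0#
  ... | tri< _ _ _ = -[1+ 0 ]
  ... | tri≈ _ _ _ = + 0
  ... | tri> _ _ _ = + 1

  cycPattern : Fin 3 → Fin 3 → ℤ
  cycPattern zero zero = + 0
  cycPattern zero (suc zero) = -[1+ 0 ]
  cycPattern zero (suc (suc zero)) = + 1
  cycPattern (suc zero) zero = + 1
  cycPattern (suc zero) (suc zero) = + 0
  cycPattern (suc zero) (suc (suc zero)) = -[1+ 0 ]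
  cycPattern (suc (suc zero)) zero = -[1+ 0 ]
  cycPattern (suc (suc zero)) (suc zero) = + 1
  cycPattern (suc (suc zero)) (suc (suc zero)) = + 0

  cyclic : Mat → Set
  cyclic B = (∀ i j → sgn (B i j) ≡ cycPattern i j)
           ⊎ (∀ i j → sgn (B i j) ≡ -ℤ (cycPattern i j))

  -- Sequences of indices.  CONVENTION: a sequence w = [k₁,…,k_r] is
  -- stored REVERSED as the list k_r ∷ … ∷ k₁ ∷ [] (head = last entry).
  Seq : Set
  Seq = List (Fin 3)

  Reduced : Seq → Set
  Reduced [] = ⊤
  Reduced (k ∷ []) = ⊤
  Reduced (k ∷ k' ∷ w) = (¬ (k ≡ k')) × Reduced (k' ∷ w)

  ext : Seq → Fin 3 → Seq
  ext [] k = k ∷ []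
  ext (k' ∷ w) k with k ≟F k'
  ... | yes _ = w
  ... | no _  = k ∷ k' ∷ w

  Bw : Mat → Seq → Mat
  Bw B [] = B
  Bw B (k ∷ w) = μ k (Bw B w)

  I : Mat
  I i j with i ≟F j
  ... | yes _ = 1#
  ... | no _  = 0#

  Cstep : Mat → Mat → Fin 3 → Mat
  Cstep C Bm k = ((C ⊗ J k) ⊕ (C ⊗ row k (posM Bm))) ⊕ (col k (posM (negM C)) ⊗ Bm)

  Cw : Mat → Seq → Mat
  Cw B [] = I
  Cw B (k ∷ w) = Cstep (Cw B w) (Bw B w) k

  clusterCyclic : Mat → Set
  clusterCyclic B = ∀ w → Reduced w → cyclic (Bw B w)

  _·_ : Sign → ℝ → ℝ
  s+ · x = x
  s- · x = - x

  TropSign : Mat → Seq → Fin 3 → Sign → Set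
  TropSign B w i e = (∀ j → 0# ≤ e · Cw B w j i) × Σ (Fin 3) (λ j → ¬ (Cw B w j i ≡ 0#))

  -- tropical sign as a function (agrees with TropSign on sign-coherent
  -- nonzero columns, which is the case for cluster-cyclic B):
  -- + if some component of c_i^w is positive, - otherwise
  epsR : ℝ → Sign
  epsR a with compare a 0#
  ... | tri> _ _ _ = s+
  ... | _ = s-

  orS : Sign → Sign → Sign
  orS s+ _ = s+
  orS s- e = e

  eps : Mat → Seq → Fin 3 → Sign
  eps B w i = orS (epsR (Cw B w zero i))
                  (orS (epsR (Cw B w (suc zero) i)) (epsR (Cw B w (suc (suc zero)) i)))

  others : Fin 3 → Fin 3 × Fin 3
  others zero = suc zero , suc (suc zero)
  others (suc zero) = zero , suc (suc zero)
  others (suc (suc zero)) = zero , suc zero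

  -- K(w): the last index of w (w ≠ ∅; arbitrary value on ∅)
  K : Seq → Fin 3
  K [] = zero
  K (k ∷ _) = k

  sgnSign : Sign → ℤ
  sgnSign s+ = + 1
  sgnSign s- = -[1+ 0 ]

  signMul : Sign → ℤ → ℤ
  signMul s+ z = z
  signMul s- z = -ℤ z

  isS : (B : Mat) → Seq → Fin 3 → Fin 3 → Data.Sign.Sign
  isS B w k s with ℤP._≟_ (signMul (eps B w s) (sgn (Bw B w k s))) -[1+ 0 ]
                 | SP._≟_ (eps B w k) (eps B w s)
  ... | yes _ | no _ = s+
  ... | _ | _ = s-

  -- S(w): the unique s ≠ K(w) satisfying condS (first candidate that
  -- satisfies it, otherwise the second one); T(w): the third index
  SandT : Mat → Seq → Fin 3 × Fin 3
  SandT B w with others (K w)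
  ... | (a , b) with isS B w (K w) a
  ...   | s+ = a , b
  ...   | s- = b , a

  S : Mat → Seq → Fin 3
  S B w = Data.Product.proj₁ (SandT B w)

  T : Mat → Seq → Fin 3
  T B w = Data.Product.proj₂ (SandT B w)

  actS : Mat → Seq → Seq
  actS B w = ext w (S B w)

  iterS : Mat → Fin 3 → ℕ → Seq
  iterS B i nzero = i ∷ []
  iterS B i (nsuc n) = actS B (iterS B i n)

  pow-1 : ℕ → Sign
  pow-1 nzero = s+
  pow-1 (nsuc n) = sopp (pow-1 n)

module Submission where

-- Write w = [i]Sⁿ, k for its last index and s for the other element of {i, s₀}.  By induction on n,
-- C = C^w and B = B^w satisfy: B is cyclic with b_ks < 0 < b_kt; the column c_k is ≤ 0; the column
-- c_t is ≥ 0 and the t-th row of C is that of I; the (k,s)-minor of C is nonzero; and the two cross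
-- terms c_lk b_ts − c_ls b_tk (l = k, s) are ≥ 0, which together with c_lk ≤ 0 forces c_s ≥ 0.
-- Mutation at s negates c_s, leaves c_t alone, exchanges the two cross terms and negates the minor,
-- so the same holds with k and s exchanged.  The signs of c_k, c_s, c_t are the tropical signs, and
-- together with b_ks < 0 < b_kt they single out S(w) = s and T(w) = t.

open import Defs
open import Level using (0ℓ)
open import Data.Fin using (Fin) renaming (zero to fzero; suc to fsuc)
open import Data.Fin.Properties using () renaming (_≟_ to _≟F_)
open import Data.Nat using (ℕ; suc; _%_) renaming (zero to nzero)
open import Data.List using ([]; _∷_)
open import Data.Sign using (Sign) renaming (+ to s+; - to s-; opposite to sopp)
open import Data.Sign.Properties using () renaming (opposite-involutive to sopp-involutive)
open import Data.Product using (Σ; _×_; _,_; proj₁; proj₂)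
open import Data.Sum using (_⊎_; inj₁; inj₂)
open import Data.Empty using (⊥; ⊥-elim)
open import Data.Unit using (tt)
open import Relation.Nullary using (¬_; yes; no)
open import Relation.Binary.Definitions using (tri<; tri≈; tri>)
open import Relation.Binary.PropositionalEquality
  using (_≡_; _≢_; refl; sym; trans; cong; cong₂; subst; subst₂; ≢-sym; module ≡-Reasoning)
open import Algebra.Bundles using (CommutativeRing)
open import Algebra.Structures using (IsCommutativeRing)
open import Relation.Binary.Structures using (IsStrictTotalOrder)
import Data.Integer as ℤ
import Data.Integer.Properties as ℤₚ
import Data.Sign.Properties as Sign
import Algebra.Properties.Ring as RingProperties
import Algebra.Properties.AbelianGroup as AbelianGroupProperties

pattern f0 = fzero
pattern f1 = fsuc fzero
pattern f2 = fsuc (fsuc fzero)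

data Perm3 : Fin 3 → Fin 3 → Fin 3 → Set where
  p012 : Perm3 f0 f1 f2
  p021 : Perm3 f0 f2 f1
  p102 : Perm3 f1 f0 f2
  p120 : Perm3 f1 f2 f0
  p201 : Perm3 f2 f0 f1
  p210 : Perm3 f2 f1 f0

module _ {k s t : Fin 3} where

  Perm3-k≢s : Perm3 k s t → k ≢ s
  Perm3-k≢s p012 ()
  Perm3-k≢s p021 ()
  Perm3-k≢s p102 ()
  Perm3-k≢s p120 ()
  Perm3-k≢s p201 ()
  Perm3-k≢s p210 ()

  Perm3-k≢t : Perm3 k s t → k ≢ t
  Perm3-k≢t p012 ()
  Perm3-k≢t p021 ()
  Perm3-k≢t p102 ()
  Perm3-k≢t p120 ()
  Perm3-k≢t p201 ()
  Perm3-k≢t p210 ()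

  Perm3-s≢t : Perm3 k s t → s ≢ t
  Perm3-s≢t p012 ()
  Perm3-s≢t p021 ()
  Perm3-s≢t p102 ()
  Perm3-s≢t p120 ()
  Perm3-s≢t p201 ()
  Perm3-s≢t p210 ()

  Perm3-swap₁₂ : Perm3 k s t → Perm3 s k t
  Perm3-swap₁₂ p012 = p102
  Perm3-swap₁₂ p021 = p201
  Perm3-swap₁₂ p102 = p012
  Perm3-swap₁₂ p120 = p210
  Perm3-swap₁₂ p201 = p021
  Perm3-swap₁₂ p210 = p120

  Perm3-swap₂₃ : Perm3 k s t → Perm3 k t s
  Perm3-swap₂₃ p012 = p021
  Perm3-swap₂₃ p021 = p012
  Perm3-swap₂₃ p102 = p120
  Perm3-swap₂₃ p120 = p102
  Perm3-swap₂₃ p201 = p210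
  Perm3-swap₂₃ p210 = p201

  Perm3-cover : Perm3 k s t → ∀ j → j ≡ k ⊎ j ≡ s ⊎ j ≡ t
  Perm3-cover p012 f0 = inj₁ refl
  Perm3-cover p012 f1 = inj₂ (inj₁ refl)
  Perm3-cover p012 f2 = inj₂ (inj₂ refl)
  Perm3-cover p021 f0 = inj₁ refl
  Perm3-cover p021 f1 = inj₂ (inj₂ refl)
  Perm3-cover p021 f2 = inj₂ (inj₁ refl)
  Perm3-cover p102 f0 = inj₂ (inj₁ refl)
  Perm3-cover p102 f1 = inj₁ refl
  Perm3-cover p102 f2 = inj₂ (inj₂ refl)
  Perm3-cover p120 f0 = inj₂ (inj₂ refl)
  Perm3-cover p120 f1 = inj₁ refl
  Perm3-cover p120 f2 = inj₂ (inj₁ refl)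
  Perm3-cover p201 f0 = inj₂ (inj₁ refl)
  Perm3-cover p201 f1 = inj₂ (inj₂ refl)
  Perm3-cover p201 f2 = inj₁ refl
  Perm3-cover p210 f0 = inj₂ (inj₂ refl)
  Perm3-cover p210 f1 = inj₂ (inj₁ refl)
  Perm3-cover p210 f2 = inj₁ refl

Perm3-complete : ∀ k → Σ (Fin 3) λ s → Σ (Fin 3) λ t → Perm3 k s t
Perm3-complete f0 = f1 , f2 , p012
Perm3-complete f1 = f0 , f2 , p102
Perm3-complete f2 = f0 , f1 , p201

module _ (F : RealField) where
  open RealField F
  open ClusterDefs F
  open IsCommutativeRing isCommutativeRing
    using (+-assoc; +-comm; +-identityˡ; +-identityʳ; *-identityˡ; *-identityʳ; *-comm; *-assoc;
           distribˡ; distribʳ; zeroˡ; zeroʳ; -‿inverseʳ; -‿inverseˡ)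
  open IsStrictTotalOrder isStrictTotalOrder using (irrefl) renaming (trans to <-trans)
  open ≡-Reasoning

  commutativeRing : CommutativeRing 0ℓ 0ℓ
  commutativeRing = record { isCommutativeRing = isCommutativeRing }

  open RingProperties (CommutativeRing.ring commutativeRing) using (-‿distribˡ-*; -‿distribʳ-*)
  open AbelianGroupProperties (CommutativeRing.+-abelianGroup commutativeRing)
    using () renaming (⁻¹-involutive to -‿involutive; ⁻¹-∙-comm to -‿+-comm; ε⁻¹≈ε to -0≡0)

  -‿*-distribˡ : ∀ a b → (- a) * b ≡ - (a * b)
  -‿*-distribˡ a b = sym (-‿distribˡ-* a b)

  -‿*-distribʳ : ∀ a b → a * (- b) ≡ - (a * b)
  -‿*-distribʳ a b = sym (-‿distribʳ-* a b)

  -‿+-distrib : ∀ a b → - (a + b) ≡ - a + - b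
  -‿+-distrib a b = sym (-‿+-comm a b)

  -x*-y≡x*y : ∀ a b → (- a) * (- b) ≡ a * b
  -x*-y≡x*y a b = trans (-‿*-distribˡ a (- b)) (trans (cong -_ (-‿*-distribʳ a b)) (-‿involutive _))

  -[-x*y]≡x*y : ∀ a b → - ((- a) * b) ≡ a * b
  -[-x*y]≡x*y a b = trans (cong -_ (-‿*-distribˡ a b)) (-‿involutive _)

  -[x*-y]≡x*y : ∀ a b → - (a * (- b)) ≡ a * b
  -[x*-y]≡x*y a b = trans (cong -_ (-‿*-distribʳ a b)) (-‿involutive _)

  [x-p]+[y+p]≡y+x : ∀ x p y → (x + - p) + (y + p) ≡ y + x
  [x-p]+[y+p]≡y+x x p y = begin
    (x + - p) + (y + p)   ≡⟨ +-assoc x (- p) (y + p) ⟩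
    x + (- p + (y + p))   ≡⟨ cong (x +_) (cong (- p +_) (+-comm y p)) ⟩
    x + (- p + (p + y))   ≡⟨ cong (x +_) (sym (+-assoc (- p) p y)) ⟩
    x + ((- p + p) + y)   ≡⟨ cong (λ z → x + (z + y)) (-‿inverseˡ p) ⟩
    x + (0# + y)          ≡⟨ cong (x +_) (+-identityˡ y) ⟩
    x + y                 ≡⟨ +-comm x y ⟩
    y + x                 ∎

  <-asym : ∀ {a b} → a < b → b < a → ⊥
  <-asym p q = irrefl refl (<-trans p q)

  <⇒≢ : ∀ {a b} → a < b → a ≢ b
  <⇒≢ p e = irrefl e p

  ≡0⊎≢0 : ∀ a → a ≡ 0# ⊎ a ≢ 0#
  ≡0⊎≢0 a with compare a 0#
  ... | tri< p _ _ = inj₂ (<⇒≢ p)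
  ... | tri≈ _ e _ = inj₁ e
  ... | tri> _ _ p = inj₂ (λ e → <⇒≢ p (sym e))

  0≤x⇒x≢0⇒0<x : ∀ {a} → 0# ≤ a → a ≢ 0# → 0# < a
  0≤x⇒x≢0⇒0<x (inj₁ p) _  = p
  0≤x⇒x≢0⇒0<x (inj₂ e) ne = ⊥-elim (ne (sym e))

  0<x⇒-x<0 : ∀ {a} → 0# < a → - a < 0#
  0<x⇒-x<0 {a} p = subst₂ _<_ (+-identityˡ (- a)) (-‿inverseʳ a) (+-mono-< (- a) p)

  x<0⇒0<-x : ∀ {a} → a < 0# → 0# < - a
  x<0⇒0<-x {a} p = subst₂ _<_ (-‿inverseʳ a) (+-identityˡ (- a)) (+-mono-< (- a) p)

  0<-x⇒x<0 : ∀ {a} → 0# < - a → a < 0#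
  0<-x⇒x<0 {a} p = subst (_< 0#) (-‿involutive a) (0<x⇒-x<0 p)

  -x<0⇒0<x : ∀ {a} → - a < 0# → 0# < a
  -x<0⇒0<x {a} p = subst (0# <_) (-‿involutive a) (x<0⇒0<-x p)

  0≤x⇒-x≤0 : ∀ {a} → 0# ≤ a → - a ≤ 0#
  0≤x⇒-x≤0 (inj₁ p) = inj₁ (0<x⇒-x<0 p)
  0≤x⇒-x≤0 (inj₂ e) = inj₂ (trans (cong -_ (sym e)) -0≡0)

  x≤0⇒0≤-x : ∀ {a} → a ≤ 0# → 0# ≤ - a
  x≤0⇒0≤-x (inj₁ p) = inj₁ (x<0⇒0<-x p)
  x≤0⇒0≤-x (inj₂ e) = inj₂ (sym (trans (cong -_ e) -0≡0))

  0≤-x⇒x≤0 : ∀ {a} → 0# ≤ - a → a ≤ 0#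
  0≤-x⇒x≤0 {a} h = subst (_≤ 0#) (-‿involutive a) (0≤x⇒-x≤0 h)

  neg*pos<0 : ∀ {a b} → a < 0# → 0# < b → a * b < 0#
  neg*pos<0 {a} {b} p q = 0<-x⇒x<0 (subst (0# <_) (-‿*-distribˡ a b) (*-pos (x<0⇒0<-x p) q))

  0<neg*neg : ∀ {a b} → a < 0# → b < 0# → 0# < a * b
  0<neg*neg {a} {b} p q = subst (0# <_) (-x*-y≡x*y a b) (*-pos (x<0⇒0<-x p) (x<0⇒0<-x q))

  nonpos*pos≤0 : ∀ {a b} → a ≤ 0# → 0# < b → a * b ≤ 0#
  nonpos*pos≤0 (inj₁ p) q = inj₁ (neg*pos<0 p q)
  nonpos*pos≤0 {a} {b} (inj₂ e) q = inj₂ (trans (cong (_* b) e) (zeroˡ b))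

  nonpos+neg<0 : ∀ {a b} → a ≤ 0# → b < 0# → a + b < 0#
  nonpos+neg<0 {a} {b} (inj₁ p) q = <-trans (subst (a + b <_) (+-identityˡ b) (+-mono-< b p)) q
  nonpos+neg<0 {a} {b} (inj₂ e) q = subst (_< 0#) (sym (trans (cong (_+ b) e) (+-identityˡ b))) q

  0<1 : 0# < 1#
  0<1 with compare 0# 1#
  ... | tri< p _ _ = p
  ... | tri≈ _ e _ = ⊥-elim (0≢1 e)
  ... | tri> _ _ p = subst (0# <_) (*-identityˡ 1#) (0<neg*neg p p)

  ≤⇒≯ : ∀ {a b} → a ≤ b → ¬ b < a
  ≤⇒≯ (inj₁ p) q = <-asym p q
  ≤⇒≯ (inj₂ e) q = irrefl (sym e) q

  0≤x*v-y*u⇒0≤y : ∀ {x y u v} → x ≤ 0# → 0# ≤ x * v + - (y * u) → u < 0# → 0# < v → 0# ≤ y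
  0≤x*v-y*u⇒0≤y {x} {y} {u} {v} x≤0 0≤cross u<0 0<v with compare y 0#
  ... | tri≈ _ e _ = inj₂ (sym e)
  ... | tri> _ _ p = inj₁ p
  ... | tri< y<0 _ _ =
    ⊥-elim (≤⇒≯ 0≤cross (nonpos+neg<0 (nonpos*pos≤0 x≤0 0<v) (0<x⇒-x<0 (0<neg*neg y<0 u<0))))

  0<x⇒[x]₊≡x : ∀ {a} → 0# < a → [ a ]₊ ≡ a
  0<x⇒[x]₊≡x {a} p with compare a 0#
  ... | tri< q _ _ = ⊥-elim (<-asym p q)
  ... | tri≈ _ e _ = ⊥-elim (irrefl (sym e) p)
  ... | tri> _ _ _ = refl

  x≤0⇒[x]₊≡0 : ∀ {a} → a ≤ 0# → [ a ]₊ ≡ 0#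
  x≤0⇒[x]₊≡0 {a} p with compare a 0#
  ... | tri< _ _ _ = refl
  ... | tri≈ _ _ _ = refl
  ... | tri> _ _ q = ⊥-elim (≤⇒≯ p q)

  [0]₊≡0 : [ 0# ]₊ ≡ 0#
  [0]₊≡0 = x≤0⇒[x]₊≡0 (inj₂ refl)

  0≤[x]₊ : ∀ a → 0# ≤ [ a ]₊
  0≤[x]₊ a with compare a 0#
  ... | tri< _ _ _ = inj₂ refl
  ... | tri≈ _ _ _ = inj₂ refl
  ... | tri> _ _ q = inj₁ q

  sgn≡-1⇒x<0 : ∀ {a} → sgn a ≡ ℤ.-[1+ 0 ] → a < 0#
  sgn≡-1⇒x<0 {a} e with compare a 0#
  sgn≡-1⇒x<0 {a} e  | tri< p _ _ = p
  sgn≡-1⇒x<0 {a} () | tri≈ _ _ _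
  sgn≡-1⇒x<0 {a} () | tri> _ _ _

  sgn≡1⇒0<x : ∀ {a} → sgn a ≡ ℤ.+ 1 → 0# < a
  sgn≡1⇒0<x {a} e with compare a 0#
  sgn≡1⇒0<x {a} () | tri< p _ _
  sgn≡1⇒0<x {a} () | tri≈ _ _ _
  sgn≡1⇒0<x {a} e  | tri> _ _ p = p

  sgn≡0⇒x≡0 : ∀ {a} → sgn a ≡ ℤ.+ 0 → a ≡ 0#
  sgn≡0⇒x≡0 {a} e with compare a 0#
  sgn≡0⇒x≡0 {a} () | tri< p _ _
  sgn≡0⇒x≡0 {a} e  | tri≈ _ q _ = q
  sgn≡0⇒x≡0 {a} () | tri> _ _ _

  x<0⇒sgn≡-1 : ∀ {a} → a < 0# → sgn a ≡ ℤ.-[1+ 0 ]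
  x<0⇒sgn≡-1 {a} p with compare a 0#
  ... | tri< _ _ _ = refl
  ... | tri≈ _ e _ = ⊥-elim (irrefl e p)
  ... | tri> _ _ q = ⊥-elim (<-asym p q)

  0<x⇒sgn≡1 : ∀ {a} → 0# < a → sgn a ≡ ℤ.+ 1
  0<x⇒sgn≡1 {a} p with compare a 0#
  ... | tri< q _ _ = ⊥-elim (<-asym p q)
  ... | tri≈ _ e _ = ⊥-elim (irrefl (sym e) p)
  ... | tri> _ _ q = refl

  x≤0⇒epsR≡- : ∀ {a} → a ≤ 0# → epsR a ≡ s-
  x≤0⇒epsR≡- {a} p with compare a 0#
  ... | tri< _ _ _ = refl
  ... | tri≈ _ _ _ = refl
  ... | tri> _ _ q = ⊥-elim (≤⇒≯ p q)

  0<x⇒epsR≡+ : ∀ {a} → 0# < a → epsR a ≡ s+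
  0<x⇒epsR≡+ {a} p with compare a 0#
  ... | tri< q _ _ = ⊥-elim (<-asym p q)
  ... | tri≈ _ e _ = ⊥-elim (irrefl (sym e) p)
  ... | tri> _ _ _ = refl

  -- Entries of J_k, row and column truncations, and products

  J-off : ∀ k i j → i ≢ j → J k i j ≡ 0#
  J-off k i j i≢j with i ≟F j
  ... | yes e = ⊥-elim (i≢j e)
  ... | no _  = refl

  J-kk : ∀ k → J k k k ≡ - 1#
  J-kk k with k ≟F k
  ... | no k≢k = ⊥-elim (k≢k refl)
  ... | yes _ with k ≟F k
  ...   | yes _   = refl
  ...   | no k≢k = ⊥-elim (k≢k refl)

  J-ii : ∀ k i → i ≢ k → J k i i ≡ 1#
  J-ii k i i≢k with i ≟F i
  ... | no i≢i = ⊥-elim (i≢i refl)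
  ... | yes _ with i ≟F k
  ...   | yes e = ⊥-elim (i≢k e)
  ...   | no _  = refl

  col-off : ∀ k (A : Mat) i j → j ≢ k → col k A i j ≡ 0#
  col-off k A i j j≢k with j ≟F k
  ... | yes e = ⊥-elim (j≢k e)
  ... | no _  = refl

  col-on : ∀ k (A : Mat) i → col k A i k ≡ A i k
  col-on k A i with k ≟F k
  ... | yes _   = refl
  ... | no k≢k = ⊥-elim (k≢k refl)

  row-off : ∀ k (A : Mat) i j → i ≢ k → row k A i j ≡ 0#
  row-off k A i j i≢k with i ≟F k
  ... | yes e = ⊥-elim (i≢k e)
  ... | no _  = refl

  row-on : ∀ k (A : Mat) j → row k A k j ≡ A k j
  row-on k A j with k ≟F k
  ... | yes _   = refl
  ... | no k≢k = ⊥-elim (k≢k refl)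

  I-off : ∀ i j → i ≢ j → I i j ≡ 0#
  I-off i j i≢j with i ≟F j
  ... | yes e = ⊥-elim (i≢j e)
  ... | no _  = refl

  I-on : ∀ i → I i i ≡ 1#
  I-on i with i ≟F i
  ... | yes _   = refl
  ... | no i≢i = ⊥-elim (i≢i refl)

  sum₃ : (Fin 3 → ℝ) → ℝ
  sum₃ f = f f0 + f f1 + f f2

  sum₃-single : ∀ f p → (∀ m → m ≢ p → f m ≡ 0#) → sum₃ f ≡ f p
  sum₃-single f f0 h rewrite h f1 (λ ()) | h f2 (λ ()) =
    trans (+-identityʳ _) (+-identityʳ _)
  sum₃-single f f1 h rewrite h f0 (λ ()) | h f2 (λ ()) =
    trans (+-identityʳ _) (+-identityˡ _)
  sum₃-single f f2 h rewrite h f0 (λ ()) | h f1 (λ ()) =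
    trans (cong (_+ f f2) (+-identityˡ 0#)) (+-identityˡ _)

  sum₃-pair : ∀ f p q → p ≢ q → (∀ m → m ≢ p → m ≢ q → f m ≡ 0#) → sum₃ f ≡ f p + f q
  sum₃-pair f f0 f0 p≢q h = ⊥-elim (p≢q refl)
  sum₃-pair f f1 f1 p≢q h = ⊥-elim (p≢q refl)
  sum₃-pair f f2 f2 p≢q h = ⊥-elim (p≢q refl)
  sum₃-pair f f0 f1 p≢q h rewrite h f2 (λ ()) (λ ()) = +-identityʳ _
  sum₃-pair f f1 f0 p≢q h rewrite h f2 (λ ()) (λ ()) = trans (+-identityʳ _) (+-comm _ _)
  sum₃-pair f f0 f2 p≢q h rewrite h f1 (λ ()) (λ ()) = cong (_+ f f2) (+-identityʳ _)
  sum₃-pair f f2 f0 p≢q h rewrite h f1 (λ ()) (λ ()) =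
    trans (cong (_+ f f2) (+-identityʳ _)) (+-comm _ _)
  sum₃-pair f f1 f2 p≢q h rewrite h f0 (λ ()) (λ ()) = cong (_+ f f2) (+-identityˡ _)
  sum₃-pair f f2 f1 p≢q h rewrite h f0 (λ ()) (λ ()) =
    trans (cong (_+ f f2) (+-identityˡ _)) (+-comm _ _)

  ⊗-row-single : ∀ (A B : Mat) i j p → (∀ m → m ≢ p → A i m ≡ 0#) → (A ⊗ B) i j ≡ A i p * B p j
  ⊗-row-single A B i j p h =
    sum₃-single (λ m → A i m * B m j) p (λ m m≢p → trans (cong (_* B m j) (h m m≢p)) (zeroˡ _))

  ⊗-col-single : ∀ (A B : Mat) i j p → (∀ m → m ≢ p → B m j ≡ 0#) → (A ⊗ B) i j ≡ A i p * B p j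
  ⊗-col-single A B i j p h =
    sum₃-single (λ m → A i m * B m j) p (λ m m≢p → trans (cong (A i m *_) (h m m≢p)) (zeroʳ _))

  ⊗-row-pair : ∀ (A B : Mat) i j p q → p ≢ q → (∀ m → m ≢ p → m ≢ q → A i m ≡ 0#) →
               (A ⊗ B) i j ≡ A i p * B p j + A i q * B q j
  ⊗-row-pair A B i j p q p≢q h = sum₃-pair (λ m → A i m * B m j) p q p≢q
    (λ m m≢p m≢q → trans (cong (_* B m j) (h m m≢p m≢q)) (zeroˡ _))

  ⊗-col-pair : ∀ (A B : Mat) i j p q → p ≢ q → (∀ m → m ≢ p → m ≢ q → B m j ≡ 0#) →
               (A ⊗ B) i j ≡ A i p * B p j + A i q * B q j
  ⊗-col-pair A B i j p q p≢q h = sum₃-pair (λ m → A i m * B m j) p q p≢q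
    (λ m m≢p m≢q → trans (cong (A i m *_) (h m m≢p m≢q)) (zeroʳ _))

  Cstep-entry : ∀ (C Bm : Mat) k i j →
                Cstep C Bm k i j ≡ C i j * J k j j + C i k * [ Bm k j ]₊ + [ - C i k ]₊ * Bm k j
  Cstep-entry C Bm k i j = cong₂ _+_ (cong₂ _+_ CJ C[B]₊) [-C]₊B
    where
    CJ : (C ⊗ J k) i j ≡ C i j * J k j j
    CJ = ⊗-col-single C (J k) i j j (λ m m≢j → J-off k m j m≢j)
    C[B]₊ : (C ⊗ row k (posM Bm)) i j ≡ C i k * [ Bm k j ]₊
    C[B]₊ = trans (⊗-col-single C (row k (posM Bm)) i j k (λ m m≢k → row-off k _ m j m≢k))
                  (cong (C i k *_) (row-on k _ j))
    [-C]₊B : (col k (posM (negM C)) ⊗ Bm) i j ≡ [ - C i k ]₊ * Bm k j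
    [-C]₊B = trans (⊗-row-single (col k (posM (negM C))) Bm i j k (λ m m≢k → col-off k _ i m m≢k))
                   (cong (_* Bm k j) (col-on k _ i))

  module MutationEntries (k : Fin 3) (B : Mat) (Bkk≡0 : B k k ≡ 0#) where
    private
      L R : Mat
      L = J k ⊕ col k (posM (negM B))
      R = J k ⊕ row k (posM B)

      L-ii : ∀ i → i ≢ k → L i i ≡ 1#
      L-ii i i≢k rewrite J-ii k i i≢k | col-off k (posM (negM B)) i i i≢k = +-identityʳ 1#

      L-ik : ∀ i → i ≢ k → L i k ≡ [ - B i k ]₊
      L-ik i i≢k rewrite J-off k i k i≢k | col-on k (posM (negM B)) i = +-identityˡ _

      L-off : ∀ i m → m ≢ i → m ≢ k → L i m ≡ 0#
      L-off i m m≢i m≢k rewrite J-off k i m (≢-sym m≢i) | col-off k (posM (negM B)) i m m≢k =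
        +-identityˡ 0#

      R-kk : R k k ≡ - 1#
      R-kk rewrite J-kk k | row-on k (posM B) k | Bkk≡0 | [0]₊≡0 = +-identityʳ _

      R-jj : ∀ j → j ≢ k → R j j ≡ 1#
      R-jj j j≢k rewrite J-ii k j j≢k | row-off k (posM B) j j j≢k = +-identityʳ _

      R-kj : ∀ j → j ≢ k → R k j ≡ [ B k j ]₊
      R-kj j j≢k rewrite J-off k k j (≢-sym j≢k) | row-on k (posM B) j = +-identityˡ _

      R-off : ∀ j m → m ≢ j → m ≢ k → R m j ≡ 0#
      R-off j m m≢j m≢k rewrite J-off k m j m≢j | row-off k (posM B) m j m≢k = +-identityˡ 0#

      LB-ij : ∀ i j → i ≢ k → (L ⊗ B) i j ≡ B i j + [ - B i k ]₊ * B k j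
      LB-ij i j i≢k = trans (⊗-row-pair L B i j i k i≢k (L-off i))
        (cong₂ _+_ (trans (cong (_* B i j) (L-ii i i≢k)) (*-identityˡ _)) (cong (_* B k j) (L-ik i i≢k)))

      LB-ik : ∀ i → i ≢ k → (L ⊗ B) i k ≡ B i k
      LB-ik i i≢k = begin
        (L ⊗ B) i k                   ≡⟨ LB-ij i k i≢k ⟩
        B i k + [ - B i k ]₊ * B k k  ≡⟨ cong (λ z → B i k + [ - B i k ]₊ * z) Bkk≡0 ⟩
        B i k + [ - B i k ]₊ * 0#     ≡⟨ cong (B i k +_) (zeroʳ _) ⟩
        B i k + 0#                    ≡⟨ +-identityʳ _ ⟩
        B i k                         ∎

    μ-ik : ∀ i → i ≢ k → μ k B i k ≡ - B i k
    μ-ik i i≢k = begin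
      μ k B i k              ≡⟨ ⊗-col-single (L ⊗ B) R i k k (λ m m≢k → R-off k m m≢k m≢k) ⟩
      (L ⊗ B) i k * R k k    ≡⟨ cong₂ _*_ (LB-ik i i≢k) R-kk ⟩
      B i k * (- 1#)         ≡⟨ -‿*-distribʳ _ _ ⟩
      - (B i k * 1#)         ≡⟨ cong -_ (*-identityʳ _) ⟩
      - B i k                ∎

    μ-ij : ∀ i j → i ≢ k → j ≢ k → μ k B i j ≡ B i j + [ - B i k ]₊ * B k j + B i k * [ B k j ]₊
    μ-ij i j i≢k j≢k = begin
      μ k B i j
        ≡⟨ ⊗-col-pair (L ⊗ B) R i j j k j≢k (R-off j) ⟩
      (L ⊗ B) i j * R j j + (L ⊗ B) i k * R k j
        ≡⟨ cong₂ _+_ (cong₂ _*_ (LB-ij i j i≢k) (R-jj j j≢k)) (cong₂ _*_ (LB-ik i i≢k) (R-kj j j≢k)) ⟩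
      (B i j + [ - B i k ]₊ * B k j) * 1# + B i k * [ B k j ]₊
        ≡⟨ cong (_+ B i k * [ B k j ]₊) (*-identityʳ _) ⟩
      B i j + [ - B i k ]₊ * B k j + B i k * [ B k j ]₊ ∎

  -- Sign patterns of cyclic matrices and tropical signs

  record CyclicAt (B : Mat) (k s t : Fin 3) : Set where
    field
      ks<0 : B k s < 0#
      sk>0 : 0# < B s k
      st<0 : B s t < 0#
      ts>0 : 0# < B t s
      tk<0 : B t k < 0#
      kt>0 : 0# < B k t
      kk≡0 : B k k ≡ 0#
      ss≡0 : B s s ≡ 0#
      tt≡0 : B t t ≡ 0#

  CyclicAt-rotate : ∀ {B k s t} → CyclicAt B k s t → CyclicAt B s t k
  CyclicAt-rotate c = record
    { ks<0 = st<0 ; sk>0 = ts>0 ; st<0 = tk<0 ; ts>0 = kt>0 ; tk<0 = ks<0 ; kt>0 = sk>0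
    ; kk≡0 = ss≡0 ; ss≡0 = tt≡0 ; tt≡0 = kk≡0 }
    where open CyclicAt c

  CyclicAt-fromSgn : ∀ {B k s t} →
    sgn (B k s) ≡ ℤ.-[1+ 0 ] → sgn (B s k) ≡ ℤ.+ 1 → sgn (B s t) ≡ ℤ.-[1+ 0 ] → sgn (B t s) ≡ ℤ.+ 1 →
    sgn (B t k) ≡ ℤ.-[1+ 0 ] → sgn (B k t) ≡ ℤ.+ 1 →
    sgn (B k k) ≡ ℤ.+ 0 → sgn (B s s) ≡ ℤ.+ 0 → sgn (B t t) ≡ ℤ.+ 0 → CyclicAt B k s t
  CyclicAt-fromSgn ks sk st ts tk kt kk ss tt′ = record
    { ks<0 = sgn≡-1⇒x<0 ks ; sk>0 = sgn≡1⇒0<x sk ; st<0 = sgn≡-1⇒x<0 st ; ts>0 = sgn≡1⇒0<x ts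
    ; tk<0 = sgn≡-1⇒x<0 tk ; kt>0 = sgn≡1⇒0<x kt
    ; kk≡0 = sgn≡0⇒x≡0 kk ; ss≡0 = sgn≡0⇒x≡0 ss ; tt≡0 = sgn≡0⇒x≡0 tt′ }

  cyclic⇒CyclicAt : ∀ {B k s t} → cyclic B → Perm3 k s t → CyclicAt B k s t ⊎ CyclicAt B s k t
  cyclic⇒CyclicAt (inj₁ h) p012 = inj₁ (CyclicAt-fromSgn (h _ _) (h _ _) (h _ _) (h _ _) (h _ _) (h _ _) (h _ _) (h _ _) (h _ _))
  cyclic⇒CyclicAt (inj₁ h) p120 = inj₁ (CyclicAt-fromSgn (h _ _) (h _ _) (h _ _) (h _ _) (h _ _) (h _ _) (h _ _) (h _ _) (h _ _))
  cyclic⇒CyclicAt (inj₁ h) p201 = inj₁ (CyclicAt-fromSgn (h _ _) (h _ _) (h _ _) (h _ _) (h _ _) (h _ _) (h _ _) (h _ _) (h _ _))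
  cyclic⇒CyclicAt (inj₁ h) p021 = inj₂ (CyclicAt-fromSgn (h _ _) (h _ _) (h _ _) (h _ _) (h _ _) (h _ _) (h _ _) (h _ _) (h _ _))
  cyclic⇒CyclicAt (inj₁ h) p102 = inj₂ (CyclicAt-fromSgn (h _ _) (h _ _) (h _ _) (h _ _) (h _ _) (h _ _) (h _ _) (h _ _) (h _ _))
  cyclic⇒CyclicAt (inj₁ h) p210 = inj₂ (CyclicAt-fromSgn (h _ _) (h _ _) (h _ _) (h _ _) (h _ _) (h _ _) (h _ _) (h _ _) (h _ _))
  cyclic⇒CyclicAt (inj₂ h) p012 = inj₂ (CyclicAt-fromSgn (h _ _) (h _ _) (h _ _) (h _ _) (h _ _) (h _ _) (h _ _) (h _ _) (h _ _))
  cyclic⇒CyclicAt (inj₂ h) p120 = inj₂ (CyclicAt-fromSgn (h _ _) (h _ _) (h _ _) (h _ _) (h _ _) (h _ _) (h _ _) (h _ _) (h _ _))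
  cyclic⇒CyclicAt (inj₂ h) p201 = inj₂ (CyclicAt-fromSgn (h _ _) (h _ _) (h _ _) (h _ _) (h _ _) (h _ _) (h _ _) (h _ _) (h _ _))
  cyclic⇒CyclicAt (inj₂ h) p021 = inj₁ (CyclicAt-fromSgn (h _ _) (h _ _) (h _ _) (h _ _) (h _ _) (h _ _) (h _ _) (h _ _) (h _ _))
  cyclic⇒CyclicAt (inj₂ h) p102 = inj₁ (CyclicAt-fromSgn (h _ _) (h _ _) (h _ _) (h _ _) (h _ _) (h _ _) (h _ _) (h _ _) (h _ _))
  cyclic⇒CyclicAt (inj₂ h) p210 = inj₁ (CyclicAt-fromSgn (h _ _) (h _ _) (h _ _) (h _ _) (h _ _) (h _ _) (h _ _) (h _ _) (h _ _))

  cyclic⇒∃CyclicAt : ∀ {B} → cyclic B → ∀ k →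
                         Σ (Fin 3) λ s → Σ (Fin 3) λ t → Perm3 k s t × CyclicAt B k s t
  cyclic⇒∃CyclicAt cy k with Perm3-complete k
  ... | a , b , p with cyclic⇒CyclicAt cy p
  ...   | inj₁ c = a , b , p , c
  ...   | inj₂ c = b , a , Perm3-swap₂₃ p , CyclicAt-rotate c

  orS-+ʳ : ∀ x → orS x s+ ≡ s+
  orS-+ʳ s+ = refl
  orS-+ʳ s- = refl

  module TropicalSigns (B : Mat) where

    eps-≤0 : ∀ w i → (∀ j → Cw B w j i ≤ 0#) → eps B w i ≡ s-
    eps-≤0 w i h rewrite x≤0⇒epsR≡- (h f0) | x≤0⇒epsR≡- (h f1) | x≤0⇒epsR≡- (h f2) = refl

    eps->0 : ∀ w i j → 0# < Cw B w j i → eps B w i ≡ s+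
    eps->0 w i f0 p rewrite 0<x⇒epsR≡+ p = refl
    eps->0 w i f1 p rewrite 0<x⇒epsR≡+ p = orS-+ʳ _
    eps->0 w i f2 p rewrite 0<x⇒epsR≡+ p | orS-+ʳ (epsR (Cw B w f1 i)) = orS-+ʳ _

    TropSign⇒eps : ∀ w i e → TropSign B w i e → eps B w i ≡ e
    TropSign⇒eps w i s- (h , _) = eps-≤0 w i (λ j → 0≤-x⇒x≤0 (h j))
    TropSign⇒eps w i s+ (h , j , c≢0) = eps->0 w i j (0≤x⇒x≢0⇒0<x (h j) c≢0)

    isS-accept : ∀ w k a → signMul (eps B w a) (sgn (Bw B w k a)) ≡ ℤ.-[1+ 0 ] →
                 eps B w k ≢ eps B w a → isS B w k a ≡ s+
    isS-accept w k a h ne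
      with ℤₚ._≟_ (signMul (eps B w a) (sgn (Bw B w k a))) ℤ.-[1+ 0 ] | Sign._≟_ (eps B w k) (eps B w a)
    ... | yes _  | no _  = refl
    ... | yes _  | yes q = ⊥-elim (ne q)
    ... | no ¬h | _     = ⊥-elim (¬h h)

    isS-reject : ∀ w k a → signMul (eps B w a) (sgn (Bw B w k a)) ≢ ℤ.-[1+ 0 ] → isS B w k a ≡ s-
    isS-reject w k a h
      with ℤₚ._≟_ (signMul (eps B w a) (sgn (Bw B w k a))) ℤ.-[1+ 0 ] | Sign._≟_ (eps B w k) (eps B w a)
    ... | yes p | _ = ⊥-elim (h p)
    ... | no _  | _ = refl

    S-T-from-isS : ∀ {k s t w} → Perm3 k s t → isS B (k ∷ w) k s ≡ s+ → isS B (k ∷ w) k t ≡ s- →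
                   S B (k ∷ w) ≡ s × T B (k ∷ w) ≡ t
    S-T-from-isS p012 acc _ rewrite acc = refl , refl
    S-T-from-isS p021 _ rej rewrite rej = refl , refl
    S-T-from-isS p102 acc _ rewrite acc = refl , refl
    S-T-from-isS p120 _ rej rewrite rej = refl , refl
    S-T-from-isS p201 acc _ rewrite acc = refl , refl
    S-T-from-isS p210 _ rej rewrite rej = refl , refl

  -- The invariant along the orbit of [i] under S

  SignCoherent : Mat → Fin 3 → Sign → Set
  SignCoherent C i e = (∀ j → 0# ≤ e · C j i) × Σ (Fin 3) λ j → C j i ≢ 0#

  cross : Mat → Mat → (k s t l : Fin 3) → ℝ
  cross C Bm k s t l = C l k * Bm t s + - (C l s * Bm t k)

  minor : Mat → Fin 3 → Fin 3 → ℝ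
  minor C k s = C k k * C s s + - (C s k * C k s)

  ac-bd≢0⇒a≢0⊎b≢0 : ∀ a b c d → a * c + - (b * d) ≢ 0# → a ≢ 0# ⊎ b ≢ 0#
  ac-bd≢0⇒a≢0⊎b≢0 a b c d h with ≡0⊎≢0 a | ≡0⊎≢0 b
  ... | inj₂ a≢0 | _        = inj₁ a≢0
  ... | inj₁ _   | inj₂ b≢0 = inj₂ b≢0
  ... | inj₁ refl | inj₁ refl =
    ⊥-elim (h (trans (cong₂ (λ x y → x + - y) (zeroˡ c) (zeroˡ d)) (trans (cong (0# +_) -0≡0) (+-identityˡ 0#))))

  ac-bd≢0⇒c≢0⊎d≢0 : ∀ a b c d → a * c + - (b * d) ≢ 0# → c ≢ 0# ⊎ d ≢ 0#
  ac-bd≢0⇒c≢0⊎d≢0 a b c d h = ac-bd≢0⇒a≢0⊎b≢0 c d a b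
    (λ e → h (trans (cong₂ (λ x y → x + - y) (*-comm a c) (*-comm b d)) e))

  record Invariant (C Bm : Mat) (k s t : Fin 3) : Set where
    field
      perm     : Perm3 k s t
      oriented : CyclicAt Bm k s t
      Ckk≤0    : C k k ≤ 0#
      Csk≤0    : C s k ≤ 0#
      Ctk≡0    : C t k ≡ 0#
      Cts≡0    : C t s ≡ 0#
      Ctt≡1    : C t t ≡ 1#
      0≤Ckt    : 0# ≤ C k t
      0≤Cst    : 0# ≤ C s t
      0≤crossₖ : 0# ≤ cross C Bm k s t k
      0≤crossₛ : 0# ≤ cross C Bm k s t s
      minor≢0  : minor C k s ≢ 0#

  module _ {C Bm k s t} (inv : Invariant C Bm k s t) where
    open Invariant inv
    open CyclicAt oriented

    Invariant-0≤Cks : 0# ≤ C k s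
    Invariant-0≤Cks = 0≤x*v-y*u⇒0≤y Ckk≤0 0≤crossₖ tk<0 ts>0

    Invariant-0≤Css : 0# ≤ C s s
    Invariant-0≤Css = 0≤x*v-y*u⇒0≤y Csk≤0 0≤crossₛ tk<0 ts>0

    Invariant-coherentₖ : SignCoherent C k s-
    Invariant-coherentₖ = nonpos , nonzero (ac-bd≢0⇒a≢0⊎b≢0 _ _ _ _ minor≢0)
      where
      nonpos : ∀ j → 0# ≤ s- · C j k
      nonpos j with Perm3-cover perm j
      ... | inj₁ refl        = x≤0⇒0≤-x Ckk≤0
      ... | inj₂ (inj₁ refl) = x≤0⇒0≤-x Csk≤0
      ... | inj₂ (inj₂ refl) = x≤0⇒0≤-x (inj₂ Ctk≡0)
      nonzero : C k k ≢ 0# ⊎ C s k ≢ 0# → Σ (Fin 3) λ j → C j k ≢ 0#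
      nonzero (inj₁ ne) = k , ne
      nonzero (inj₂ ne) = s , ne

    Invariant-coherentₛ : SignCoherent C s s+
    Invariant-coherentₛ = nonneg , nonzero (ac-bd≢0⇒c≢0⊎d≢0 _ _ _ _ minor≢0)
      where
      nonneg : ∀ j → 0# ≤ s+ · C j s
      nonneg j with Perm3-cover perm j
      ... | inj₁ refl        = Invariant-0≤Cks
      ... | inj₂ (inj₁ refl) = Invariant-0≤Css
      ... | inj₂ (inj₂ refl) = inj₂ (sym Cts≡0)
      nonzero : C s s ≢ 0# ⊎ C k s ≢ 0# → Σ (Fin 3) λ j → C j s ≢ 0#
      nonzero (inj₁ ne) = s , ne
      nonzero (inj₂ ne) = k , ne

    Invariant-coherentₜ : SignCoherent C t s+
    Invariant-coherentₜ = nonneg , (t , λ e → 0≢1 (trans (sym e) Ctt≡1))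
      where
      nonneg : ∀ j → 0# ≤ s+ · C j t
      nonneg j with Perm3-cover perm j
      ... | inj₁ refl        = 0≤Ckt
      ... | inj₂ (inj₁ refl) = 0≤Cst
      ... | inj₂ (inj₂ refl) = inj₁ (subst (0# <_) (sym Ctt≡1) 0<1)

  module _ (B : Mat) where
    open TropicalSigns B

    Invariant⇒S-T : ∀ {k w s t} → Invariant (Cw B (k ∷ w)) (Bw B (k ∷ w)) k s t →
                    S B (k ∷ w) ≡ s × T B (k ∷ w) ≡ t
    Invariant⇒S-T {k} {w} {s} {t} inv = S-T-from-isS perm s-accepted t-rejected
      where
      open Invariant inv
      open CyclicAt oriented
      εₖ : eps B (k ∷ w) k ≡ s-
      εₖ = TropSign⇒eps (k ∷ w) k s- (Invariant-coherentₖ inv)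
      εₛ : eps B (k ∷ w) s ≡ s+
      εₛ = TropSign⇒eps (k ∷ w) s s+ (Invariant-coherentₛ inv)
      εₜ : eps B (k ∷ w) t ≡ s+
      εₜ = TropSign⇒eps (k ∷ w) t s+ (Invariant-coherentₜ inv)
      s-accepted : isS B (k ∷ w) k s ≡ s+
      s-accepted = isS-accept (k ∷ w) k s (cong₂ signMul εₛ (x<0⇒sgn≡-1 ks<0))
        (λ e → Sign.s≢opposite[s] s- (trans (sym εₖ) (trans e εₛ)))
      t-rejected : isS B (k ∷ w) k t ≡ s-
      t-rejected = isS-reject (k ∷ w) k t
        (λ e → +1≢-1 (trans (sym (cong₂ signMul εₜ (0<x⇒sgn≡1 kt>0))) e))
        where
        +1≢-1 : ℤ.+ 1 ≢ ℤ.-[1+ 0 ]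
        +1≢-1 ()

  cross-mutation-identity : ∀ x y u v b →
    (- y) * (u + v * b) + - ((x + y * b) * (- v)) ≡ x * v + - (y * u)
  cross-mutation-identity x y u v b = begin
    (- y) * (u + v * b) + - ((x + y * b) * (- v))
      ≡⟨ cong₂ _+_ expand (trans (-[x*-y]≡x*y (x + y * b) v) (distribʳ v x (y * b))) ⟩
    (- (y * u) + - (y * b * v)) + (x * v + y * b * v)
      ≡⟨ [x-p]+[y+p]≡y+x (- (y * u)) (y * b * v) (x * v) ⟩
    x * v + - (y * u) ∎
    where
    expand : (- y) * (u + v * b) ≡ - (y * u) + - (y * b * v)
    expand = begin
      (- y) * (u + v * b)         ≡⟨ -‿*-distribˡ y _ ⟩
      - (y * (u + v * b))         ≡⟨ cong -_ (distribˡ y u (v * b)) ⟩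
      - (y * u + y * (v * b))     ≡⟨ -‿+-distrib _ _ ⟩
      - (y * u) + - (y * (v * b)) ≡⟨ cong (λ z → - (y * u) + - z) (trans (cong (y *_) (*-comm v b)) (sym (*-assoc y b v))) ⟩
      - (y * u) + - (y * b * v)   ∎

  minor-mutation-identity : ∀ a c d e b →
    (- e) * (a + c * b) + - ((- c) * (d + e * b)) ≡ - (a * e + - (d * c))
  minor-mutation-identity a c d e b = begin
    (- e) * (a + c * b) + - ((- c) * (d + e * b))
      ≡⟨ cong₂ _+_ expand (trans (-[-x*y]≡x*y c _) (distribˡ c d (e * b))) ⟩
    (- (e * a) + - (c * (e * b))) + (c * d + c * (e * b))
      ≡⟨ [x-p]+[y+p]≡y+x (- (e * a)) (c * (e * b)) (c * d) ⟩
    c * d + - (e * a)         ≡⟨ +-comm _ _ ⟩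
    - (e * a) + c * d         ≡⟨ cong₂ _+_ (cong -_ (*-comm e a)) (trans (*-comm c d) (sym (-‿involutive _))) ⟩
    - (a * e) + - (- (d * c)) ≡⟨ sym (-‿+-distrib _ _) ⟩
    - (a * e + - (d * c))     ∎
    where
    expand : (- e) * (a + c * b) ≡ - (e * a) + - (c * (e * b))
    expand = begin
      (- e) * (a + c * b)         ≡⟨ -‿*-distribˡ e _ ⟩
      - (e * (a + c * b))         ≡⟨ cong -_ (distribˡ e a (c * b)) ⟩
      - (e * a + e * (c * b))     ≡⟨ -‿+-distrib _ _ ⟩
      - (e * a) + - (e * (c * b)) ≡⟨ cong (λ z → - (e * a) + - z) (trans (sym (*-assoc e c b)) (trans (cong (_* b) (*-comm e c)) (*-assoc c e b))) ⟩
      - (e * a) + - (c * (e * b)) ∎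

  module InvariantStep {C Bm k s t} (inv : Invariant C Bm k s t) where
    open Invariant inv
    open CyclicAt oriented
    open MutationEntries s Bm ss≡0 using (μ-ik; μ-ij)

    private
      C′ B′ : Mat
      C′ = Cstep C Bm s
      B′ = μ s Bm

      b : ℝ
      b = Bm s k

      k≢s : k ≢ s
      k≢s = Perm3-k≢s perm

      s≢t : s ≢ t
      s≢t = Perm3-s≢t perm

      C′ls : ∀ l → 0# ≤ C l s → C′ l s ≡ - C l s
      C′ls l 0≤Cls = begin
        C′ l s
          ≡⟨ Cstep-entry C Bm s l s ⟩
        C l s * J s s s + C l s * [ Bm s s ]₊ + [ - C l s ]₊ * Bm s s
          ≡⟨ cong₂ _+_ (cong₂ _+_ (cong (C l s *_) (J-kk s)) (cong (λ z → C l s * [ z ]₊) ss≡0))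
                       (cong₂ _*_ (x≤0⇒[x]₊≡0 (0≤x⇒-x≤0 0≤Cls)) ss≡0) ⟩
        C l s * - 1# + C l s * [ 0# ]₊ + 0# * 0#
          ≡⟨ cong₂ _+_ (cong (λ z → C l s * - 1# + C l s * z) [0]₊≡0) (zeroˡ 0#) ⟩
        C l s * - 1# + C l s * 0# + 0#
          ≡⟨ trans (+-identityʳ _) (cong (C l s * - 1# +_) (zeroʳ _)) ⟩
        C l s * - 1# + 0#
          ≡⟨ trans (+-identityʳ _) (trans (-‿*-distribʳ _ _) (cong -_ (*-identityʳ _))) ⟩
        - C l s ∎

      C′lk : ∀ l → 0# ≤ C l s → C′ l k ≡ C l k + C l s * b
      C′lk l 0≤Cls = begin
        C′ l k
          ≡⟨ Cstep-entry C Bm s l k ⟩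
        C l k * J s k k + C l s * [ b ]₊ + [ - C l s ]₊ * b
          ≡⟨ cong₂ _+_ (cong₂ _+_ (cong (C l k *_) (J-ii s k k≢s)) (cong (C l s *_) (0<x⇒[x]₊≡x sk>0)))
                       (cong (_* b) (x≤0⇒[x]₊≡0 (0≤x⇒-x≤0 0≤Cls))) ⟩
        C l k * 1# + C l s * b + 0# * b
          ≡⟨ trans (cong₂ _+_ (cong (_+ C l s * b) (*-identityʳ _)) (zeroˡ b)) (+-identityʳ _) ⟩
        C l k + C l s * b ∎

      C′lt : ∀ l → 0# ≤ C l s → C′ l t ≡ C l t
      C′lt l 0≤Cls = begin
        C′ l t
          ≡⟨ Cstep-entry C Bm s l t ⟩
        C l t * J s t t + C l s * [ Bm s t ]₊ + [ - C l s ]₊ * Bm s t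
          ≡⟨ cong₂ _+_ (cong₂ _+_ (cong (C l t *_) (J-ii s t (≢-sym s≢t))) (cong (C l s *_) (x≤0⇒[x]₊≡0 (inj₁ st<0))))
                       (cong (_* Bm s t) (x≤0⇒[x]₊≡0 (0≤x⇒-x≤0 0≤Cls))) ⟩
        C l t * 1# + C l s * 0# + 0# * Bm s t
          ≡⟨ cong₂ _+_ (cong₂ _+_ (*-identityʳ _) (zeroʳ _)) (zeroˡ _) ⟩
        C l t + 0# + 0#
          ≡⟨ trans (+-identityʳ _) (+-identityʳ _) ⟩
        C l t ∎

      B′ts : B′ t s ≡ - Bm t s
      B′ts = μ-ik t (≢-sym s≢t)

      B′tk : B′ t k ≡ Bm t k + Bm t s * b
      B′tk = begin
        B′ t k
          ≡⟨ μ-ij t k (≢-sym s≢t) k≢s ⟩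
        Bm t k + [ - Bm t s ]₊ * b + Bm t s * [ b ]₊
          ≡⟨ cong₂ _+_ (cong (λ z → Bm t k + z * b) (x≤0⇒[x]₊≡0 (inj₁ (0<x⇒-x<0 ts>0))))
                       (cong (Bm t s *_) (0<x⇒[x]₊≡x sk>0)) ⟩
        Bm t k + 0# * b + Bm t s * b
          ≡⟨ cong (_+ Bm t s * b) (trans (cong (Bm t k +_) (zeroˡ _)) (+-identityʳ _)) ⟩
        Bm t k + Bm t s * b ∎

      0≤Cts : 0# ≤ C t s
      0≤Cts = inj₂ (sym Cts≡0)

      cross′≡cross : ∀ l → 0# ≤ C l s → cross C′ B′ s k t l ≡ cross C Bm k s t l
      cross′≡cross l 0≤Cls = begin
        C′ l s * B′ t k + - (C′ l k * B′ t s)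
          ≡⟨ cong₂ (λ x y → x + - y) (cong₂ _*_ (C′ls l 0≤Cls) B′tk) (cong₂ _*_ (C′lk l 0≤Cls) B′ts) ⟩
        (- C l s) * (Bm t k + Bm t s * b) + - ((C l k + C l s * b) * (- Bm t s))
          ≡⟨ cross-mutation-identity _ _ _ _ _ ⟩
        C l k * Bm t s + - (C l s * Bm t k) ∎

      minor′≡-minor : minor C′ s k ≡ - minor C k s
      minor′≡-minor = begin
        C′ s s * C′ k k + - (C′ k s * C′ s k)
          ≡⟨ cong₂ (λ x y → x + - y) (cong₂ _*_ (C′ls s (Invariant-0≤Css inv)) (C′lk k (Invariant-0≤Cks inv)))
                                     (cong₂ _*_ (C′ls k (Invariant-0≤Cks inv)) (C′lk s (Invariant-0≤Css inv))) ⟩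
        (- C s s) * (C k k + C k s * b) + - ((- C k s) * (C s k + C s s * b))
          ≡⟨ minor-mutation-identity _ _ _ _ _ ⟩
        - minor C k s ∎

      -- Cyclicity of B′ leaves two orientations; B′ t s = - Bm t s < 0 rules out the other one.
      oriented′ : cyclic B′ → CyclicAt B′ s k t
      oriented′ cy with cyclic⇒CyclicAt cy (Perm3-swap₁₂ perm)
      ... | inj₁ c = c
      ... | inj₂ c = ⊥-elim (<-asym (CyclicAt.ts>0 c) (subst (_< 0#) (sym B′ts) (0<x⇒-x<0 ts>0)))

    Invariant-step : cyclic (μ s Bm) → Invariant (Cstep C Bm s) (μ s Bm) s k t
    Invariant-step cy = record
      { perm     = Perm3-swap₁₂ perm
      ; oriented = oriented′ cy
      ; Ckk≤0    = subst (_≤ 0#) (sym (C′ls s 0≤Css)) (0≤x⇒-x≤0 0≤Css)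
      ; Csk≤0    = subst (_≤ 0#) (sym (C′ls k 0≤Cks)) (0≤x⇒-x≤0 0≤Cks)
      ; Ctk≡0    = trans (C′ls t 0≤Cts) (trans (cong -_ Cts≡0) -0≡0)
      ; Cts≡0    = trans (C′lk t 0≤Cts) (trans (cong₂ (λ x y → x + y * b) Ctk≡0 Cts≡0)
                                               (trans (+-identityˡ _) (zeroˡ b)))
      ; Ctt≡1    = trans (C′lt t 0≤Cts) Ctt≡1
      ; 0≤Ckt    = subst (0# ≤_) (sym (C′lt s 0≤Css)) 0≤Cst
      ; 0≤Cst    = subst (0# ≤_) (sym (C′lt k 0≤Cks)) 0≤Ckt
      ; 0≤crossₖ = subst (0# ≤_) (sym (cross′≡cross s 0≤Css)) 0≤crossₛ
      ; 0≤crossₛ = subst (0# ≤_) (sym (cross′≡cross k 0≤Cks)) 0≤crossₖ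
      ; minor≢0  = λ e → minor≢0 (trans (sym (-‿involutive _)) (trans (cong -_ (trans (sym minor′≡-minor) e)) -0≡0))
      }
      where
      0≤Cks : 0# ≤ C k s
      0≤Cks = Invariant-0≤Cks inv
      0≤Css : 0# ≤ C s s
      0≤Css = Invariant-0≤Css inv

  open InvariantStep using (Invariant-step)

  module InitialInvariant {B i s t} (cy : cyclic B) (perm : Perm3 i s t) (oriented₁ : CyclicAt (μ i B) i s t) where
    private
      C₁ B₁ : Mat
      C₁ = Cstep I B i
      B₁ = μ i B

      i≢s : i ≢ s
      i≢s = Perm3-k≢s perm

      i≢t : i ≢ t
      i≢t = Perm3-k≢t perm

      s≢t : s ≢ t
      s≢t = Perm3-s≢t perm

      Bii≡0 : B i i ≡ 0#
      Bii≡0 = CyclicAt.kk≡0 (proj₂ (proj₂ (proj₂ (cyclic⇒∃CyclicAt cy i))))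

      open MutationEntries i B Bii≡0 using (μ-ik; μ-ij)

      B₁ti≡-Bti : B₁ t i ≡ - B t i
      B₁ti≡-Bti = μ-ik t (≢-sym i≢t)

      0<Bti : 0# < B t i
      0<Bti = -x<0⇒0<x (subst (_< 0#) B₁ti≡-Bti (CyclicAt.tk<0 oriented₁))

      -- B itself has the opposite orientation, as B t i = - (μ i B) t i > 0.
      oriented₀ : CyclicAt B s i t
      oriented₀ with cyclic⇒CyclicAt cy perm
      ... | inj₁ c = ⊥-elim (<-asym (CyclicAt.tk<0 c) 0<Bti)
      ... | inj₂ c = c

      open CyclicAt oriented₀

      B₁ts : B₁ t s ≡ B t s + B t i * B i s
      B₁ts = begin
        B₁ t s
          ≡⟨ μ-ij t s (≢-sym i≢t) (≢-sym i≢s) ⟩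
        B t s + [ - B t i ]₊ * B i s + B t i * [ B i s ]₊
          ≡⟨ cong₂ _+_ (cong (λ z → B t s + z * B i s) (x≤0⇒[x]₊≡0 (inj₁ (0<x⇒-x<0 0<Bti))))
                       (cong (B t i *_) (0<x⇒[x]₊≡x sk>0)) ⟩
        B t s + 0# * B i s + B t i * B i s
          ≡⟨ cong (_+ B t i * B i s) (trans (cong (B t s +_) (zeroˡ _)) (+-identityʳ _)) ⟩
        B t s + B t i * B i s ∎

      C₁-other-row : ∀ l m → l ≢ i → C₁ l m ≡ I l m * J i m m
      C₁-other-row l m l≢i = begin
        C₁ l m
          ≡⟨ Cstep-entry I B i l m ⟩
        I l m * J i m m + I l i * [ B i m ]₊ + [ - I l i ]₊ * B i m
          ≡⟨ cong (λ z → I l m * J i m m + z * [ B i m ]₊ + [ - z ]₊ * B i m) (I-off l i l≢i) ⟩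
        I l m * J i m m + 0# * [ B i m ]₊ + [ - 0# ]₊ * B i m
          ≡⟨ cong₂ _+_ (cong (I l m * J i m m +_) (zeroˡ _))
                       (trans (cong (λ z → [ z ]₊ * B i m) -0≡0) (trans (cong (_* B i m) [0]₊≡0) (zeroˡ _))) ⟩
        I l m * J i m m + 0# + 0#
          ≡⟨ trans (+-identityʳ _) (+-identityʳ _) ⟩
        I l m * J i m m ∎

      C₁-row-i : ∀ m → C₁ i m ≡ I i m * J i m m + [ B i m ]₊
      C₁-row-i m = begin
        C₁ i m
          ≡⟨ Cstep-entry I B i i m ⟩
        I i m * J i m m + I i i * [ B i m ]₊ + [ - I i i ]₊ * B i m
          ≡⟨ cong (λ z → I i m * J i m m + z * [ B i m ]₊ + [ - z ]₊ * B i m) (I-on i) ⟩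
        I i m * J i m m + 1# * [ B i m ]₊ + [ - 1# ]₊ * B i m
          ≡⟨ cong₂ _+_ (cong (I i m * J i m m +_) (*-identityˡ _))
                       (trans (cong (_* B i m) (x≤0⇒[x]₊≡0 (inj₁ (0<x⇒-x<0 0<1)))) (zeroˡ _)) ⟩
        I i m * J i m m + [ B i m ]₊ + 0#
          ≡⟨ +-identityʳ _ ⟩
        I i m * J i m m + [ B i m ]₊ ∎

      C₁-off : ∀ l m → l ≢ i → l ≢ m → C₁ l m ≡ 0#
      C₁-off l m l≢i l≢m = trans (C₁-other-row l m l≢i) (trans (cong (_* J i m m) (I-off l m l≢m)) (zeroˡ _))

      C₁-ll : ∀ l → l ≢ i → C₁ l l ≡ 1#
      C₁-ll l l≢i = trans (C₁-other-row l l l≢i) (trans (cong₂ _*_ (I-on l) (J-ii i l l≢i)) (*-identityˡ _))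

      C₁-im : ∀ m → m ≢ i → C₁ i m ≡ [ B i m ]₊
      C₁-im m m≢i = trans (C₁-row-i m)
        (trans (cong (_+ [ B i m ]₊) (trans (cong (_* J i m m) (I-off i m (≢-sym m≢i))) (zeroˡ _))) (+-identityˡ _))

      C₁ii : C₁ i i ≡ - 1#
      C₁ii = trans (C₁-row-i i)
        (trans (cong₂ _+_ (cong₂ _*_ (I-on i) (J-kk i)) (trans (cong [_]₊ Bii≡0) [0]₊≡0))
               (trans (+-identityʳ _) (*-identityˡ _)))

      C₁is : C₁ i s ≡ B i s
      C₁is = trans (C₁-im s (≢-sym i≢s)) (0<x⇒[x]₊≡x sk>0)

      C₁si≡0 : C₁ s i ≡ 0#
      C₁si≡0 = C₁-off s i (≢-sym i≢s) (≢-sym i≢s)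

      crossᵢ : cross C₁ B₁ i s t i ≡ - B t s
      crossᵢ = begin
        C₁ i i * B₁ t s + - (C₁ i s * B₁ t i)
          ≡⟨ cong₂ (λ x y → x + - y) (cong₂ _*_ C₁ii B₁ts) (cong₂ _*_ C₁is B₁ti≡-Bti) ⟩
        (- 1#) * (B t s + B t i * B i s) + - (B i s * (- B t i))
          ≡⟨ cong₂ _+_ (trans (-‿*-distribˡ 1# _) (cong -_ (*-identityˡ _))) (-[x*-y]≡x*y _ _) ⟩
        - (B t s + B t i * B i s) + B i s * B t i
          ≡⟨ cong₂ _+_ (-‿+-distrib _ _) (*-comm _ _) ⟩
        (- B t s + - (B t i * B i s)) + B t i * B i s
          ≡⟨ +-assoc _ _ _ ⟩
        - B t s + (- (B t i * B i s) + B t i * B i s)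
          ≡⟨ cong (- B t s +_) (-‿inverseˡ _) ⟩
        - B t s + 0#
          ≡⟨ +-identityʳ _ ⟩
        - B t s ∎

      crossₛ : cross C₁ B₁ i s t s ≡ B t i
      crossₛ = begin
        C₁ s i * B₁ t s + - (C₁ s s * B₁ t i)
          ≡⟨ cong₂ (λ x y → x * B₁ t s + - y) C₁si≡0 (cong₂ _*_ (C₁-ll s (≢-sym i≢s)) B₁ti≡-Bti) ⟩
        0# * B₁ t s + - (1# * - B t i)
          ≡⟨ cong₂ _+_ (zeroˡ _) (cong -_ (*-identityˡ _)) ⟩
        0# + - (- B t i)
          ≡⟨ trans (+-identityˡ _) (-‿involutive _) ⟩
        B t i ∎

      minor₁ : minor C₁ i s ≡ - 1#
      minor₁ = begin
        C₁ i i * C₁ s s + - (C₁ s i * C₁ i s)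
          ≡⟨ cong₂ (λ x y → x + - (y * C₁ i s)) (cong₂ _*_ C₁ii (C₁-ll s (≢-sym i≢s))) C₁si≡0 ⟩
        (- 1#) * 1# + - (0# * C₁ i s)
          ≡⟨ cong₂ _+_ (*-identityʳ _) (trans (cong -_ (zeroˡ _)) -0≡0) ⟩
        - 1# + 0#
          ≡⟨ +-identityʳ _ ⟩
        - 1# ∎

    Invariant-init : Invariant (Cstep I B i) (μ i B) i s t
    Invariant-init = record
      { perm     = perm
      ; oriented = oriented₁
      ; Ckk≤0    = inj₁ (subst (_< 0#) (sym C₁ii) (0<x⇒-x<0 0<1))
      ; Csk≤0    = inj₂ C₁si≡0
      ; Ctk≡0    = C₁-off t i (≢-sym i≢t) (≢-sym i≢t)
      ; Cts≡0    = C₁-off t s (≢-sym i≢t) (≢-sym s≢t)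
      ; Ctt≡1    = C₁-ll t (≢-sym i≢t)
      ; 0≤Ckt    = subst (0# ≤_) (sym (C₁-im t (≢-sym i≢t))) (0≤[x]₊ _)
      ; 0≤Cst    = inj₂ (sym (C₁-off s t (≢-sym i≢s) s≢t))
      ; 0≤crossₖ = subst (0# ≤_) (sym crossᵢ) (inj₁ (x<0⇒0<-x tk<0))
      ; 0≤crossₛ = subst (0# ≤_) (sym crossₛ) (inj₁ 0<Bti)
      ; minor≢0  = λ e → <⇒≢ (0<x⇒-x<0 0<1) (trans (sym minor₁) e)
      }

  open InitialInvariant using (Invariant-init)

  pick : Sign → Fin 3 → Fin 3 → Fin 3
  pick s+ a b = a
  pick s- a b = b

  pow-1-parity : ∀ n → (n % 2 ≡ 0 → pow-1 n ≡ s+) × (n % 2 ≡ 1 → pow-1 n ≡ s-)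
  pow-1-parity nzero = (λ _ → refl) , (λ ())
  pow-1-parity (suc nzero) = (λ ()) , (λ _ → refl)
  pow-1-parity (suc (suc n)) with pow-1-parity n
  ... | even , odd = (λ e → trans (sopp-involutive (pow-1 n)) (even e))
                   , (λ e → trans (sopp-involutive (pow-1 n)) (odd e))

  ext-≢ : ∀ k w s → s ≢ k → ext (k ∷ w) s ≡ s ∷ k ∷ w
  ext-≢ k w s s≢k with s ≟F k
  ... | yes e = ⊥-elim (s≢k e)
  ... | no _  = refl

  module Orbit (B : Mat) (cc : clusterCyclic B) (i : Fin 3) where

    advance : ∀ {k w s t} → Reduced (k ∷ w) → Invariant (Cw B (k ∷ w)) (Bw B (k ∷ w)) k s t →
              actS B (k ∷ w) ≡ s ∷ k ∷ w × Reduced (s ∷ k ∷ w) ×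
              Invariant (Cw B (s ∷ k ∷ w)) (Bw B (s ∷ k ∷ w)) s k t
    advance {k} {w} {s} red inv =
      trans (cong (ext (k ∷ w)) (proj₁ (Invariant⇒S-T B inv))) (ext-≢ k w s s≢k) ,
      red′ , Invariant-step inv (cc (s ∷ k ∷ w) red′)
      where
      s≢k : s ≢ k
      s≢k = ≢-sym (Perm3-k≢s (Invariant.perm inv))
      red′ : Reduced (s ∷ k ∷ w)
      red′ = s≢k , red

    private
      start : Σ (Fin 3) λ s → Σ (Fin 3) λ t → Perm3 i s t × CyclicAt (Bw B (i ∷ [])) i s t
      start = cyclic⇒∃CyclicAt (cc (i ∷ []) tt) i

    s₀ t₀ : Fin 3
    s₀ = proj₁ start
    t₀ = proj₁ (proj₂ start)

    Invariant₀ : Invariant (Cw B (i ∷ [])) (Bw B (i ∷ [])) i s₀ t₀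
    Invariant₀ = Invariant-init (cc [] tt) (proj₁ (proj₂ (proj₂ start))) (proj₂ (proj₂ (proj₂ start)))

    S₀≡s₀ : S B (i ∷ []) ≡ s₀
    S₀≡s₀ = proj₁ (Invariant⇒S-T B Invariant₀)

    T₀≡t₀ : T B (i ∷ []) ≡ t₀
    T₀≡t₀ = proj₂ (Invariant⇒S-T B Invariant₀)

    -- e = (-1)^n records whether the last two mutations were at (s₀, i) or at (i, s₀).
    OrbitPoint : Seq → Sign → Set
    OrbitPoint w e = let k = pick e i s₀ in
      Σ Seq λ w′ → w ≡ k ∷ w′ × Reduced (k ∷ w′) × Invariant (Cw B (k ∷ w′)) (Bw B (k ∷ w′)) k (pick e s₀ i) t₀

    OrbitPoint-S : ∀ {w} e → OrbitPoint w e → OrbitPoint (actS B w) (sopp e)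
    OrbitPoint-S s+ (w′ , refl , red , inv) = i ∷ w′ , advance red inv
    OrbitPoint-S s- (w′ , refl , red , inv) = s₀ ∷ w′ , advance red inv

    orbit : ∀ n → OrbitPoint (iterS B i n) (pow-1 n)
    orbit nzero   = [] , refl , tt , Invariant₀
    orbit (suc n) = OrbitPoint-S (pow-1 n) (orbit n)

    Conclusion : ℕ → Seq → Sign → Fin 3 → Fin 3 → Set
    Conclusion n w e s t =
      ((n % 2 ≡ 0 → K w ≡ i × S B w ≡ s) × (n % 2 ≡ 1 → K w ≡ s × S B w ≡ i) × T B w ≡ t)
      × (TropSign B w i (sopp e) × TropSign B w s e × TropSign B w t s+)

    OrbitPoint⇒conclusion : ∀ e n → (n % 2 ≡ 0 → e ≡ s+) → (n % 2 ≡ 1 → e ≡ s-) →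
                            ∀ {w} → OrbitPoint w e → Conclusion n w e s₀ t₀
    OrbitPoint⇒conclusion s+ n _ odd (w′ , refl , _ , inv) =
      ((λ _ → refl , proj₁ S-T) , (λ h → ⊥-elim (Sign.s≢opposite[s] s+ (odd h))) , proj₂ S-T)
      , Invariant-coherentₖ inv , Invariant-coherentₛ inv , Invariant-coherentₜ inv
      where
      S-T : S B (i ∷ w′) ≡ s₀ × T B (i ∷ w′) ≡ t₀
      S-T = Invariant⇒S-T B inv
    OrbitPoint⇒conclusion s- n even _ (w′ , refl , _ , inv) =
      ((λ h → ⊥-elim (Sign.s≢opposite[s] s+ (sym (even h)))) , (λ _ → refl , proj₁ S-T) , proj₂ S-T)
      , Invariant-coherentₛ inv , Invariant-coherentₖ inv , Invariant-coherentₜ inv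
      where
      S-T : S B (s₀ ∷ w′) ≡ i × T B (s₀ ∷ w′) ≡ t₀
      S-T = Invariant⇒S-T B inv

proposition6p6 : (F : RealField) → let open ClusterDefs F in
    (B : Mat) → skewSymmetrizable B → clusterCyclic B →
    (i : Fin 3) → (n : ℕ) →
    let k₀ = K (i ∷ [])
        s₀ = S B (i ∷ [])
        t₀ = T B (i ∷ [])
        w  = iterS B i n
    in ((n % 2 ≡ 0 → (K w ≡ k₀) × (S B w ≡ s₀))
         × (n % 2 ≡ 1 → (K w ≡ s₀) × (S B w ≡ k₀))
         × (T B w ≡ t₀))
       × (TropSign B w k₀ (pow-1 (suc n))
          × TropSign B w s₀ (pow-1 n)
          × TropSign B w t₀ s+)
proposition6p6 F B _ cc i n =
  subst₂ (Conclusion n (iterS B i n) (pow-1 n)) (sym S₀≡s₀) (sym T₀≡t₀)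
    (OrbitPoint⇒conclusion (pow-1 n) n (proj₁ (pow-1-parity F n)) (proj₂ (pow-1-parity F n)) (orbit n))
  where
  open ClusterDefs F using (pow-1; iterS)
  open Orbit F B cc i
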